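{- For all integers $n,p,m\ge0$ (and $k\ge1$) and every real $x$, the polynomials $H_{n,p}(m;x)$ defined below satisfy \[ H_{n+1,p}(m;x)=\frac{l\,(p+1)\,(p+a+m)^{k}}{(p+a+m+1)^{k}}\,H_{n,p+1}(m;x)-q\,(x+p)\,H_{n,p}(m;x), \] and $H_{0,p}(m;x)=\dfrac{l^{a}}{a^{k}}$.
   Context: Let $k\ge1$ be an integer, let $a,q,l_1,\dots,l_k$ be nonzero reals, $l=\prod_{i=1}^k l_i$, $L=(l_1,\dots,l_k)$; denominators $a+j$ ($j\ge0$ integer) are assumed nonzero and $l^{a+i}$ means $l^a l^i$. Let $s(n,i)$ be the signed Stirling numbers of the first kind ($\frac{1}{i!}(\ln(1+x))^i=\sum_{n\ge i}s(n,i)\frac{x^n}{n!}$) and $\left\{ {n \atop i} \right\}$ the Stirling numbers of the second kind. Define \[ \mathcal{B}_{n,m}^{(k)}(a,q,L)=\frac{(a+m)^k}{a^k}\sum_{i=0}^{n}\frac{i!\,(-q)^{n-i}\,l^{i+a}}{(a+m+i)^k}\left\{ {n \atop i} \right\}, \] \[ H_{n,p}(m)=\frac{1}{p!\,l^{p}}\Big(\frac{p+a+m}{a+m}\Big)^{k}\sum_{i=0}^{p}s(p,i)(-q)^{p-i}\mathcal{B}_{n+i,m}^{(k)}(a,q,L), \] and the polynomials \[ H_{n,p}(m;x)=\sum_{i=0}^{n}\binom{n}{i}(-q)^{n-i}H_{i,p}(m)\,x^{n-i}. \] -}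

module Defs where

open import Level using (Level; _⊔_) renaming (suc to lsuc)
open import Data.Nat as ℕ using (ℕ; zero; suc; _!)
open import Data.Nat.Combinatorics using (_C_)
open import Data.Integer as ℤ using (ℤ; +_; -[1+_])
open import Data.Vec using (Vec; []; _∷_)
open import Relation.Nullary using (¬_)
open import Algebra.Bundles using (CommutativeRing)

stirling1 : ℕ → ℕ → ℤ
stirling1 zero    zero    = ℤ.+ 1
stirling1 zero    (suc i) = ℤ.+ 0
stirling1 (suc n) zero    = ℤ.+ 0
stirling1 (suc n) (suc i) = stirling1 n i ℤ.- (ℤ.+ n) ℤ.* stirling1 n (suc i)

stirling2 : ℕ → ℕ → ℕ
stirling2 zero    zero    = 1
stirling2 zero    (suc i) = 0
stirling2 (suc n) zero    = 0
stirling2 (suc n) (suc i) = stirling2 n i ℕ.+ suc i ℕ.* stirling2 n (suc i)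

-- Fields (the stdlib has no Field bundle): a commutative ring with
-- 0 ≠ 1 and a (total) inverse operation that is a genuine inverse on
-- nonzero elements.

record Field (c ℓ : Level) : Set (lsuc (c ⊔ ℓ)) where
  field
    commutativeRing : CommutativeRing c ℓ
  open CommutativeRing commutativeRing public
  field
    _⁻¹      : Carrier → Carrier
    0≉1      : ¬ (0# ≈ 1#)
    inverse  : ∀ x → ¬ (x ≈ 0#) → x * (x ⁻¹) ≈ 1#

module FieldDefs {c ℓ : Level} (F : Field c ℓ) where
  open Field F

  natF : ℕ → Carrier
  natF zero    = 0#
  natF (suc n) = 1# + natF n

  intF : ℤ → Carrier
  intF (+ n)      = natF n
  intF -[1+ n ]   = - natF (suc n)

  pow : Carrier → ℕ → Carrier
  pow x zero    = 1#
  pow x (suc n) = x * pow x n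

  -- ∑_{i=0}^{n} f i  (inclusive upper bound)
  sumTo : ℕ → (ℕ → Carrier) → Carrier
  sumTo zero    f = f 0
  sumTo (suc n) f = sumTo n f + f (suc n)

  prodV : ∀ {k} → Vec Carrier k → Carrier
  prodV []       = 1#
  prodV (x ∷ xs) = x * prodV xs

  CharacteristicZero : Set ℓ
  CharacteristicZero = ∀ j → ¬ (natF (suc j) ≈ 0#)

  -- Parameters: k, a, q, l (= product of the l_i) and la (= l^a).
  -- The power l^{i+a} is interpreted as la * l^i, as in the paper.

  calB : (k : ℕ) (a q l la : Carrier) → ℕ → ℕ → Carrier
  calB k a q l la n m =
    (pow (a + natF m) k * (pow a k) ⁻¹) *
    sumTo n (λ i →
      (natF (i !) * pow (- q) (n ℕ.∸ i) * (la * pow l i))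
        * (pow (a + natF m + natF i) k) ⁻¹
        * natF (stirling2 n i))

  Hc : (k : ℕ) (a q l la : Carrier) → ℕ → ℕ → ℕ → Carrier
  Hc k a q l la n p m =
    ((natF (p !)) ⁻¹ * (pow l p) ⁻¹) *
    pow ((natF p + a + natF m) * (a + natF m) ⁻¹) k *
    sumTo p (λ i → intF (stirling1 p i) * pow (- q) (p ℕ.∸ i)
                     * calB k a q l la (n ℕ.+ i) m)

  Hpoly : (k : ℕ) (a q l la : Carrier) → ℕ → ℕ → ℕ → Carrier → Carrier
  Hpoly k a q l la n p m x =
    sumTo n (λ i → natF (n C i) * pow (- q) (n ℕ.∸ i)
                     * Hc k a q l la i p m * pow x (n ℕ.∸ i))

-- Write H_{n,p}(m) = W_p · S₁[p](B_{n+·}) with W_p = ((p+a+m)/(a+m))^k / (p! l^p) and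
-- S₁[p](g) = ∑ᵢ s(p,i) (-q)^{p-i} g(i). The recurrence s(p+1,i+1) = s(p,i) - p s(p,i+1)
-- gives S₁[p](g ∘ suc) = S₁[p+1](g) - pq S₁[p](g), hence
-- H_{n+1,p} = (W_p / W_{p+1}) H_{n,p+1} - pq H_{n,p}, and W_p / W_{p+1} is the coefficient of
-- the theorem. The Appell-type recurrence of the binomial sums defining H_{n,p}(m;x) turns
-- this into the stated recurrence. For H_{0,p}(m;x) = H_{0,p}(m), note that B_{i,m} is, up to
-- the factor ((a+m)/a)^k, the Stirling transform of the second kind of
-- f(j) = j! l^{a+j} / (a+m+j)^k, and the two Stirling transforms are mutually inverse,
-- so H_{0,p}(m) = W_p ((a+m)/a)^k f(p) = l^a / a^k.
module Submission where

open import Defs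
open import Level using (Level)
open import Data.Nat.Base as ℕ using (ℕ; zero; suc; _≤_; _<_; _∸_; _!; s≤s)
import Data.Nat.Properties as ℕₚ
open import Data.Nat.Combinatorics using (_C_; k>n⇒nCk≡0; nCk+nC[k+1]≡[n+1]C[k+1])
open import Data.Integer.Base as ℤ using (ℤ; +_; -[1+_]; _⊖_; _◃_)
import Data.Integer.Properties as ℤₚ
open import Data.Sign.Base as Sign using ()
open import Data.Maybe.Base using (Maybe; just; nothing)
open import Data.Vec.Base using (Vec; []; _∷_)
open import Data.Vec.Relation.Unary.All using (All; []; _∷_)
open import Data.Product.Base using (_×_; _,_)
open import Function.Base using (_∘_)
open import Relation.Nullary using (¬_; yes; no)
open import Relation.Binary.PropositionalEquality as ≡ using (_≡_)
open import Algebra.Solver.Ring.AlmostCommutativeRing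
  using (fromCommutativeRing; _-Raw-AlmostCommutative⟶_)

stirling1-vanishes : ∀ {p i} → p < i → stirling1 p i ≡ + 0
stirling1-vanishes {zero}  {suc i} _ = ≡.refl
stirling1-vanishes {suc p} {suc i} (s≤s p<i)
  rewrite stirling1-vanishes p<i | stirling1-vanishes (ℕₚ.m<n⇒m<1+n p<i)
        | ℤₚ.*-zeroʳ (+ p) = ≡.refl

stirling2-vanishes : ∀ {p i} → p < i → stirling2 p i ≡ 0
stirling2-vanishes {zero}  {suc i} _ = ≡.refl
stirling2-vanishes {suc p} {suc i} (s≤s p<i)
  rewrite stirling2-vanishes p<i | stirling2-vanishes (ℕₚ.m<n⇒m<1+n p<i)
        | ℕₚ.*-zeroʳ (suc i) = ≡.refl

module _ {c ℓ : Level} (F : Field c ℓ) where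
  open Field F
  open FieldDefs F
  open import Relation.Binary.Reasoning.Setoid setoid
  open import Algebra.Properties.Ring ring
    using (-0#≈0#; -‿involutive; -‿+-comm; -‿distribˡ-*; -‿distribʳ-*; +-cancelʳ)
  open import Algebra.Properties.CommutativeSemigroup +-commutativeSemigroup
    using (interchange)
  open import Algebra.Properties.Semiring.Mult semiring
    using (×-homo-+; ×1-homo-*) renaming (_×_ to _·_)

  NonZero : Carrier → Set ℓ
  NonZero x = ¬ (x ≈ 0#)

  natF≡·1# : ∀ n → natF n ≡ n · 1#
  natF≡·1# zero    = ≡.refl
  natF≡·1# (suc n) = ≡.cong (_+_ 1#) (natF≡·1# n)

  natF-+ : ∀ m n → natF (m ℕ.+ n) ≈ natF m + natF n
  natF-+ m n rewrite natF≡·1# m | natF≡·1# n | natF≡·1# (m ℕ.+ n) = ×-homo-+ 1# m n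

  natF-* : ∀ m n → natF (m ℕ.* n) ≈ natF m * natF n
  natF-* m n rewrite natF≡·1# m | natF≡·1# n | natF≡·1# (m ℕ.* n) = ×1-homo-* m n

  natF-1 : natF 1 ≈ 1#
  natF-1 = +-identityʳ 1#

  intF-⊖ : ∀ m n → intF (m ⊖ n) ≈ natF m - natF n
  intF-⊖ m       zero    = sym (trans (+-congˡ -0#≈0#) (+-identityʳ _))
  intF-⊖ zero    (suc n) = sym (+-identityˡ _)
  intF-⊖ (suc m) (suc n) = begin
    intF (suc m ⊖ suc n)                ≈⟨ reflexive (≡.cong intF (ℤₚ.[1+m]⊖[1+n]≡m⊖n m n)) ⟩
    intF (m ⊖ n)                        ≈⟨ intF-⊖ m n ⟩
    natF m - natF n                     ≈⟨ +-identityˡ _ ⟨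
    0# + (natF m - natF n)              ≈⟨ +-congʳ (-‿inverseʳ 1#) ⟨
    (1# - 1#) + (natF m - natF n)       ≈⟨ interchange _ _ _ _ ⟨
    (1# + natF m) + (- 1# + - natF n)   ≈⟨ +-congˡ (-‿+-comm 1# (natF n)) ⟩
    (1# + natF m) - (1# + natF n)       ∎

  intF-+ : ∀ i j → intF (i ℤ.+ j) ≈ intF i + intF j
  intF-+ -[1+ m ] -[1+ n ] = begin
    - natF (suc (suc (m ℕ.+ n)))     ≈⟨ -‿cong (reflexive (≡.cong (natF ∘ suc) (ℕₚ.+-suc m n))) ⟨
    - natF (suc m ℕ.+ suc n)         ≈⟨ -‿cong (natF-+ (suc m) (suc n)) ⟩
    - (natF (suc m) + natF (suc n))  ≈⟨ -‿+-comm _ _ ⟨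
    - natF (suc m) + - natF (suc n)  ∎
  intF-+ -[1+ m ] (+ n)    = trans (intF-⊖ n (suc m)) (+-comm _ _)
  intF-+ (+ m)    -[1+ n ] = intF-⊖ m (suc n)
  intF-+ (+ m)    (+ n)    = natF-+ m n

  intF-neg : ∀ i → intF (ℤ.- i) ≈ - intF i
  intF-neg -[1+ n ]    = sym (-‿involutive _)
  intF-neg (+ zero)    = sym -0#≈0#
  intF-neg (+ (suc n)) = refl

  intF-pos◃ : ∀ n → intF (Sign.+ ◃ n) ≈ natF n
  intF-pos◃ zero    = refl
  intF-pos◃ (suc n) = refl

  intF-neg◃ : ∀ n → intF (Sign.- ◃ n) ≈ - natF n
  intF-neg◃ zero    = sym -0#≈0#
  intF-neg◃ (suc n) = refl

  intF-* : ∀ i j → intF (i ℤ.* j) ≈ intF i * intF j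
  intF-* -[1+ m ] -[1+ n ] = begin
    intF (Sign.+ ◃ (suc m ℕ.* suc n))
      ≈⟨ trans (intF-pos◃ (suc m ℕ.* suc n)) (natF-* (suc m) (suc n)) ⟩
    natF (suc m) * natF (suc n)        ≈⟨ *-congʳ (-‿involutive _) ⟨
    - - natF (suc m) * natF (suc n)    ≈⟨ -‿distribˡ-* _ _ ⟨
    - (- natF (suc m) * natF (suc n))  ≈⟨ -‿distribʳ-* _ _ ⟩
    - natF (suc m) * - natF (suc n)    ∎
  intF-* -[1+ m ] (+ n) =
    trans (intF-neg◃ (suc m ℕ.* n)) (trans (-‿cong (natF-* (suc m) n)) (-‿distribˡ-* _ _))
  intF-* (+ m) -[1+ n ] =
    trans (intF-neg◃ (m ℕ.* suc n)) (trans (-‿cong (natF-* m (suc n))) (-‿distribʳ-* _ _))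
  intF-* (+ m) (+ n) = trans (intF-pos◃ (m ℕ.* n)) (natF-* m n)

  intF-homomorphism : ℤ.+-*-rawRing -Raw-AlmostCommutative⟶ fromCommutativeRing commutativeRing
  intF-homomorphism = record
    { ⟦_⟧ = intF ; +-homo = intF-+ ; *-homo = intF-* ; -‿homo = intF-neg
    ; 0-homo = refl ; 1-homo = natF-1 }

  intF-≟ : ∀ i j → Maybe (intF i ≈ intF j)
  intF-≟ i j with i ℤₚ.≟ j
  ... | yes i≡j = just (reflexive (≡.cong intF i≡j))
  ... | no _    = nothing

  open import Algebra.Solver.Ring ℤ.+-*-rawRing (fromCommutativeRing commutativeRing)
    intF-homomorphism intF-≟

  intF-stirling1-suc : ∀ p i →
    intF (stirling1 (suc p) (suc i)) ≈ intF (stirling1 p i) - natF p * intF (stirling1 p (suc i))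
  intF-stirling1-suc p i = begin
    intF (s ℤ.- + p ℤ.* s′)            ≈⟨ intF-+ s (ℤ.- (+ p ℤ.* s′)) ⟩
    intF s + intF (ℤ.- (+ p ℤ.* s′))
      ≈⟨ +-congˡ (trans (intF-neg (+ p ℤ.* s′)) (-‿cong (intF-* (+ p) s′))) ⟩
    intF s - natF p * intF s′          ∎
    where
    s = stirling1 p i
    s′ = stirling1 p (suc i)

  natF-stirling2-suc : ∀ n j →
    natF (stirling2 (suc n) (suc j)) ≈ natF (stirling2 n j) + natF (suc j) * natF (stirling2 n (suc j))
  natF-stirling2-suc n j =
    trans (natF-+ (stirling2 n j) _) (+-congˡ (natF-* (suc j) (stirling2 n (suc j))))

  sumTo-cong≤ : ∀ n {f g : ℕ → Carrier} → (∀ i → i ≤ n → f i ≈ g i) → sumTo n f ≈ sumTo n g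
  sumTo-cong≤ zero    f≈g = f≈g 0 ℕ.z≤n
  sumTo-cong≤ (suc n) f≈g =
    +-cong (sumTo-cong≤ n (λ i i≤n → f≈g i (ℕₚ.m≤n⇒m≤1+n i≤n))) (f≈g (suc n) ℕₚ.≤-refl)

  sumTo-cong : ∀ n {f g : ℕ → Carrier} → (∀ i → f i ≈ g i) → sumTo n f ≈ sumTo n g
  sumTo-cong n f≈g = sumTo-cong≤ n (λ i _ → f≈g i)

  sumTo-+ : ∀ n (f g : ℕ → Carrier) → sumTo n (λ i → f i + g i) ≈ sumTo n f + sumTo n g
  sumTo-+ zero    f g = refl
  sumTo-+ (suc n) f g = trans (+-congʳ (sumTo-+ n f g)) (interchange _ _ _ _)

  sumTo-*ˡ : ∀ n x (f : ℕ → Carrier) → sumTo n (λ i → x * f i) ≈ x * sumTo n f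
  sumTo-*ˡ zero    x f = refl
  sumTo-*ˡ (suc n) x f = trans (+-congʳ (sumTo-*ˡ n x f)) (sym (distribˡ _ _ _))

  sumTo-uncons : ∀ n (f : ℕ → Carrier) → sumTo (suc n) f ≈ f 0 + sumTo n (f ∘ suc)
  sumTo-uncons zero    f = refl
  sumTo-uncons (suc n) f = trans (+-congʳ (sumTo-uncons n f)) (+-assoc _ _ _)

  sumTo-dropHead : ∀ n (f : ℕ → Carrier) → f 0 ≈ 0# → sumTo (suc n) f ≈ sumTo n (f ∘ suc)
  sumTo-dropHead n f f0≈0 = trans (sumTo-uncons n f) (trans (+-congʳ f0≈0) (+-identityˡ _))

  sumTo-dropLast : ∀ n (f : ℕ → Carrier) → f (suc n) ≈ 0# → sumTo (suc n) f ≈ sumTo n f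
  sumTo-dropLast n f fn≈0 = trans (+-congˡ fn≈0) (+-identityʳ _)

  -- t i e is the i-th summand with exponent e; only i ≤ n occurs, so the truncated
  -- subtraction suc n ∸ i is suc (n ∸ i) throughout.
  sumTo-factorExponent : ∀ n r (t : ℕ → ℕ → Carrier) → (∀ i e → t i (suc e) ≈ r * t i e) →
    sumTo n (λ i → t i (suc n ∸ i)) ≈ r * sumTo n (λ i → t i (n ∸ i))
  sumTo-factorExponent n r t t-suc = trans
    (sumTo-cong≤ n (λ i i≤n →
      trans (reflexive (≡.cong (t i) (ℕₚ.+-∸-assoc 1 i≤n))) (t-suc i (n ∸ i))))
    (sumTo-*ˡ n r _)

  0*x*y≈0 : ∀ x y → 0# * x * y ≈ 0#
  0*x*y≈0 x y = trans (*-congʳ (zeroˡ x)) (zeroˡ y)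

  NonZero-resp : ∀ {x y} → x ≈ y → NonZero y → NonZero x
  NonZero-resp x≈y y≉0 x≈0 = y≉0 (trans (sym x≈y) x≈0)

  unit-cancelˡ : ∀ {x y} z → x * y ≈ 1# → x * y * z ≈ z
  unit-cancelˡ z xy≈1 = trans (*-congʳ xy≈1) (*-identityˡ z)

  *-nonZero : ∀ {x y} → NonZero x → NonZero y → NonZero (x * y)
  *-nonZero {x} {y} x≉0 y≉0 xy≈0 = x≉0 (begin
    x                ≈⟨ unit-cancelˡ x (inverse y y≉0) ⟨
    y * y ⁻¹ * x     ≈⟨ solve 3 (λ y u x → y :* u :* x := x :* y :* u) refl y (y ⁻¹) x ⟩
    x * y * y ⁻¹     ≈⟨ *-congʳ xy≈0 ⟩
    0# * y ⁻¹        ≈⟨ zeroˡ _ ⟩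
    0#               ∎)

  pow-nonZero : ∀ {x} k → NonZero x → NonZero (pow x k)
  pow-nonZero zero    x≉0 1≈0 = 0≉1 (sym 1≈0)
  pow-nonZero (suc k) x≉0     = *-nonZero x≉0 (pow-nonZero k x≉0)

  prodV-nonZero : ∀ {k} (xs : Vec Carrier k) → All NonZero xs → NonZero (prodV xs)
  prodV-nonZero []       []           1≈0 = 0≉1 (sym 1≈0)
  prodV-nonZero (x ∷ xs) (x≉0 ∷ xs≉0) = *-nonZero x≉0 (prodV-nonZero xs xs≉0)

  !-nonZero : CharacteristicZero → ∀ p → NonZero (natF (p !))
  !-nonZero char0 zero    = char0 0
  !-nonZero char0 (suc p) =
    NonZero-resp (natF-* (suc p) (p !)) (*-nonZero (char0 p) (!-nonZero char0 p))

  ⁻¹-unique : ∀ {x} y → NonZero x → x * y ≈ 1# → y ≈ x ⁻¹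
  ⁻¹-unique {x} y x≉0 xy≈1 = begin
    y                 ≈⟨ unit-cancelˡ y (inverse x x≉0) ⟨
    x * x ⁻¹ * y      ≈⟨ solve 3 (λ x u y → x :* u :* y := u :* (x :* y)) refl x (x ⁻¹) y ⟩
    x ⁻¹ * (x * y)    ≈⟨ *-congˡ xy≈1 ⟩
    x ⁻¹ * 1#         ≈⟨ *-identityʳ _ ⟩
    x ⁻¹              ∎

  ⁻¹-cong : ∀ {x y} → NonZero y → x ≈ y → x ⁻¹ ≈ y ⁻¹
  ⁻¹-cong y≉0 x≈y = ⁻¹-unique _ y≉0
    (trans (*-congʳ (sym x≈y)) (inverse _ (NonZero-resp x≈y y≉0)))

  ⁻¹-distrib-* : ∀ {x y} → NonZero x → NonZero y → (x * y) ⁻¹ ≈ x ⁻¹ * y ⁻¹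
  ⁻¹-distrib-* {x} {y} x≉0 y≉0 = sym (⁻¹-unique _ (*-nonZero x≉0 y≉0) (begin
    x * y * (x ⁻¹ * y ⁻¹)    ≈⟨ solve 4 (λ x y u v → x :* y :* (u :* v) := x :* u :* (y :* v))
                                   refl x y (x ⁻¹) (y ⁻¹) ⟩
    x * x ⁻¹ * (y * y ⁻¹)    ≈⟨ unit-cancelˡ _ (inverse x x≉0) ⟩
    y * y ⁻¹                 ≈⟨ inverse y y≉0 ⟩
    1#                       ∎))

  pow-cong : ∀ {x y} k → x ≈ y → pow x k ≈ pow y k
  pow-cong zero    x≈y = refl
  pow-cong (suc k) x≈y = *-cong x≈y (pow-cong k x≈y)

  pow-distrib-* : ∀ x y k → pow (x * y) k ≈ pow x k * pow y k
  pow-distrib-* x y zero    = sym (*-identityˡ 1#)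
  pow-distrib-* x y (suc k) = trans (*-congˡ (pow-distrib-* x y k))
    (solve 4 (λ x y u v → x :* y :* (u :* v) := x :* u :* (y :* v)) refl x y _ _)

  pow-1# : ∀ k → pow 1# k ≈ 1#
  pow-1# zero    = refl
  pow-1# (suc k) = trans (*-identityˡ _) (pow-1# k)

  pow-inverse : ∀ {x} k → NonZero x → pow x k * pow (x ⁻¹) k ≈ 1#
  pow-inverse {x} k x≉0 =
    trans (sym (pow-distrib-* x (x ⁻¹) k)) (trans (pow-cong k (inverse x x≉0)) (pow-1# k))

  stirling1Sum : Carrier → ℕ → (ℕ → Carrier) → Carrier
  stirling1Sum r p g = sumTo p (λ i → intF (stirling1 p i) * pow r (p ∸ i) * g i)

  stirling2Sum : Carrier → ℕ → (ℕ → Carrier) → Carrier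
  stirling2Sum r n f = sumTo n (λ j → pow r (n ∸ j) * natF (stirling2 n j) * f j)

  stirling1Sum-cong : ∀ r p {g h : ℕ → Carrier} → (∀ i → g i ≈ h i) →
    stirling1Sum r p g ≈ stirling1Sum r p h
  stirling1Sum-cong r p g≈h = sumTo-cong p (λ i → *-congˡ (g≈h i))

  stirling1Sum-+ : ∀ r p (g h : ℕ → Carrier) →
    stirling1Sum r p (λ i → g i + h i) ≈ stirling1Sum r p g + stirling1Sum r p h
  stirling1Sum-+ r p g h = trans (sumTo-cong p (λ i → distribˡ _ (g i) (h i))) (sumTo-+ p _ _)

  stirling1Sum-*ˡ : ∀ r p x (g : ℕ → Carrier) →
    stirling1Sum r p (λ i → x * g i) ≈ x * stirling1Sum r p g
  stirling1Sum-*ˡ r p x g = trans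
    (sumTo-cong p (λ i → solve 3 (λ w x g → w :* (x :* g) := x :* (w :* g)) refl _ x (g i)))
    (sumTo-*ˡ p x _)

  stirling1Sum-shifted : ∀ r p (g : ℕ → Carrier) →
    sumTo (suc p) (λ i → intF (stirling1 (suc p) (suc i)) * pow r (suc p ∸ i) * g (suc i))
      ≈ r * stirling1Sum r (suc p) g
  stirling1Sum-shifted r p g = begin
    sumTo (suc p) (λ i → t i (suc p ∸ i))
      ≈⟨ sumTo-dropLast p _ (trans (*-congʳ (*-congʳ (reflexive
           (≡.cong intF (stirling1-vanishes (ℕₚ.n<1+n (suc p))))))) (0*x*y≈0 _ _)) ⟩
    sumTo p (λ i → t i (suc p ∸ i))
      ≈⟨ sumTo-factorExponent p r t (λ i e →
           solve 4 (λ s r w x → s :* (r :* w) :* x := r :* (s :* w :* x)) refl _ r _ _) ⟩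
    r * sumTo p (λ i → t i (p ∸ i))
      ≈⟨ *-congˡ (sumTo-dropHead p _ (0*x*y≈0 _ _)) ⟨
    r * stirling1Sum r (suc p) g ∎
    where
    t : ℕ → ℕ → Carrier
    t i e = intF (stirling1 (suc p) (suc i)) * pow r e * g (suc i)

  stirling1Sum-suc : ∀ r p (g : ℕ → Carrier) →
    stirling1Sum r (suc p) g + natF p * (r * stirling1Sum r p g) ≈ stirling1Sum r p (g ∘ suc)
  stirling1Sum-suc r p g = begin
    stirling1Sum r (suc p) g + natF p * (r * stirling1Sum r p g)
      ≈⟨ +-cong (sumTo-dropHead p _ (0*x*y≈0 _ _)) (shifted p) ⟩
    sumTo p X′ + natF p * sumTo p Y    ≈⟨ +-congˡ (sumTo-*ˡ p (natF p) Y) ⟨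
    sumTo p X′ + sumTo p (λ i → natF p * Y i)   ≈⟨ sumTo-+ p _ _ ⟨
    sumTo p (λ i → X′ i + natF p * Y i)
      ≈⟨ sumTo-cong p (λ i → trans (+-congʳ (*-congʳ (*-congʳ (intF-stirling1-suc p i))))
           (solve 5 (λ s s′ n w x → (s :- n :* s′) :* w :* x :+ n :* (s′ :* w :* x) := s :* w :* x)
              refl _ _ (natF p) _ _)) ⟩
    stirling1Sum r p (g ∘ suc) ∎
    where
    X′ Y : ℕ → Carrier
    X′ i = intF (stirling1 (suc p) (suc i)) * pow r (p ∸ i) * g (suc i)
    Y i = intF (stirling1 p (suc i)) * pow r (p ∸ i) * g (suc i)
    -- for p = 0 the shifted sum is not r · S₁[0](g), but the factor p kills both sides
    shifted : ∀ n → natF n * (r * stirling1Sum r n g)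
                    ≈ natF n * sumTo n (λ i → intF (stirling1 n (suc i)) * pow r (n ∸ i) * g (suc i))
    shifted zero    = trans (zeroˡ _) (sym (zeroˡ _))
    shifted (suc n) = *-congˡ (sym (stirling1Sum-shifted r n g))

  stirling2Sum-shifted : ∀ r n (f : ℕ → Carrier) →
    sumTo n (λ j → pow r (n ∸ j) * natF (stirling2 n (suc j)) * (natF (suc j) * f (suc j)))
      ≈ r * stirling2Sum r n (λ j → natF j * f j)
  stirling2Sum-shifted r zero f = begin
    1# * 0# * (natF 1 * f 1)           ≈⟨ trans (*-congʳ (zeroʳ 1#)) (zeroˡ _) ⟩
    0#                                 ≈⟨ zeroʳ r ⟨
    r * 0#                             ≈⟨ *-congˡ (trans (*-congˡ (zeroˡ (f 0))) (zeroʳ _)) ⟨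
    r * (1# * natF 1 * (0# * f 0))     ∎
  stirling2Sum-shifted r (suc n) f = begin
    sumTo (suc n) (λ j → t j (suc n ∸ j))
      ≈⟨ sumTo-dropLast n _ (trans (*-congʳ (trans (*-congˡ (reflexive
           (≡.cong natF (stirling2-vanishes (ℕₚ.n<1+n (suc n)))))) (zeroʳ _))) (zeroˡ _)) ⟩
    sumTo n (λ j → t j (suc n ∸ j))
      ≈⟨ sumTo-factorExponent n r t (λ j e →
           solve 4 (λ r w s x → r :* w :* s :* x := r :* (w :* s :* x)) refl r _ _ _) ⟩
    r * sumTo n (λ j → t j (n ∸ j))
      ≈⟨ *-congˡ (sumTo-dropHead n _ (trans (*-congˡ (zeroˡ _)) (zeroʳ _))) ⟨
    r * stirling2Sum r (suc n) (λ j → natF j * f j) ∎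
    where
    t : ℕ → ℕ → Carrier
    t j e = pow r e * natF (stirling2 (suc n) (suc j)) * (natF (suc j) * f (suc j))

  stirling2Sum-suc : ∀ r n (f : ℕ → Carrier) →
    stirling2Sum r (suc n) f ≈ stirling2Sum r n (f ∘ suc) + r * stirling2Sum r n (λ j → natF j * f j)
  stirling2Sum-suc r n f = begin
    stirling2Sum r (suc n) f
      ≈⟨ sumTo-dropHead n _ (trans (*-congʳ (zeroʳ _)) (zeroˡ _)) ⟩
    sumTo n (λ j → pow r (n ∸ j) * natF (stirling2 (suc n) (suc j)) * f (suc j))
      ≈⟨ sumTo-cong n (λ j → trans (*-congʳ (*-congˡ (natF-stirling2-suc n j)))
           (solve 5 (λ w s k s′ x → w :* (s :+ k :* s′) :* x := w :* s :* x :+ w :* s′ :* (k :* x))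
              refl _ _ _ _ _)) ⟩
    sumTo n (λ j → pow r (n ∸ j) * natF (stirling2 n j) * f (suc j)
                   + pow r (n ∸ j) * natF (stirling2 n (suc j)) * (natF (suc j) * f (suc j)))
      ≈⟨ sumTo-+ n _ _ ⟩
    stirling2Sum r n (f ∘ suc)
      + sumTo n (λ j → pow r (n ∸ j) * natF (stirling2 n (suc j)) * (natF (suc j) * f (suc j)))
      ≈⟨ +-congˡ (stirling2Sum-shifted r n f) ⟩
    stirling2Sum r n (f ∘ suc) + r * stirling2Sum r n (λ j → natF j * f j) ∎

  stirling1Sum-stirling2Sum : ∀ r p (f : ℕ → Carrier) →
    stirling1Sum r p (λ i → stirling2Sum r i f) ≈ f p
  stirling1Sum-stirling2Sum r zero f = begin
    natF 1 * 1# * (1# * natF 1 * f 0)   ≈⟨ *-cong (*-congʳ natF-1) (*-congʳ (*-congˡ natF-1)) ⟩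
    1# * 1# * (1# * 1# * f 0)           ≈⟨ unit-cancelˡ _ (*-identityˡ 1#) ⟩
    1# * 1# * f 0                       ≈⟨ unit-cancelˡ _ (*-identityˡ 1#) ⟩
    f 0                                 ∎
  stirling1Sum-stirling2Sum r (suc p) f = +-cancelʳ (natF p * (r * f p)) _ _ (begin
    stirling1Sum r (suc p) V + natF p * (r * f p)
      ≈⟨ +-congˡ (*-congˡ (*-congˡ (stirling1Sum-stirling2Sum r p f))) ⟨
    stirling1Sum r (suc p) V + natF p * (r * stirling1Sum r p V)
      ≈⟨ stirling1Sum-suc r p V ⟩
    stirling1Sum r p (V ∘ suc)
      ≈⟨ stirling1Sum-cong r p (λ i → stirling2Sum-suc r i f) ⟩
    stirling1Sum r p (λ i → stirling2Sum r i (f ∘ suc) + r * stirling2Sum r i (λ j → natF j * f j))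
      ≈⟨ trans (stirling1Sum-+ r p _ _) (+-congˡ (stirling1Sum-*ˡ r p r _)) ⟩
    stirling1Sum r p (λ i → stirling2Sum r i (f ∘ suc))
      + r * stirling1Sum r p (λ i → stirling2Sum r i (λ j → natF j * f j))
      ≈⟨ +-cong (stirling1Sum-stirling2Sum r p (f ∘ suc))
                (*-congˡ (stirling1Sum-stirling2Sum r p (λ j → natF j * f j))) ⟩
    f (suc p) + r * (natF p * f p)
      ≈⟨ +-congˡ (solve 3 (λ r n x → r :* (n :* x) := n :* (r :* x)) refl r _ _) ⟩
    f (suc p) + natF p * (r * f p) ∎)
    where
    V : ℕ → Carrier
    V i = stirling2Sum r i f

  binomialSum : Carrier → Carrier → ℕ → (ℕ → Carrier) → Carrier
  binomialSum r x n h = sumTo n (λ i → natF (n C i) * pow r (n ∸ i) * h i * pow x (n ∸ i))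

  binomialSum-cong : ∀ r x n {g h : ℕ → Carrier} → (∀ i → g i ≈ h i) →
    binomialSum r x n g ≈ binomialSum r x n h
  binomialSum-cong r x n g≈h = sumTo-cong n (λ i → *-congʳ (*-congˡ (g≈h i)))

  binomialSum-+ : ∀ r x n (g h : ℕ → Carrier) →
    binomialSum r x n (λ i → g i + h i) ≈ binomialSum r x n g + binomialSum r x n h
  binomialSum-+ r x n g h = trans
    (sumTo-cong n (λ i → solve 4 (λ w g h y → w :* (g :+ h) :* y := w :* g :* y :+ w :* h :* y)
       refl _ (g i) (h i) _))
    (sumTo-+ n _ _)

  binomialSum-*ˡ : ∀ r x n y (h : ℕ → Carrier) →
    binomialSum r x n (λ i → y * h i) ≈ y * binomialSum r x n h
  binomialSum-*ˡ r x n y h = trans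
    (sumTo-cong n (λ i → solve 4 (λ w y h v → w :* (y :* h) :* v := y :* (w :* h :* v))
       refl _ y (h i) _))
    (sumTo-*ˡ n y _)

  binomialSum-zero : ∀ r x (h : ℕ → Carrier) → binomialSum r x 0 h ≈ h 0
  binomialSum-zero r x h =
    trans (*-identityʳ _) (trans (*-congʳ (trans (*-identityʳ _) natF-1)) (*-identityˡ _))

  binomialSum-suc : ∀ r x n (h : ℕ → Carrier) →
    binomialSum r x (suc n) h ≈ (r * x) * binomialSum r x n h + binomialSum r x n (h ∘ suc)
  binomialSum-suc r x n h = begin
    binomialSum r x (suc n) h                       ≈⟨ sumTo-uncons n _ ⟩
    T 0 + sumTo n (λ i → T (suc i))                 ≈⟨ +-congˡ (sumTo-cong n pascal) ⟩
    T 0 + sumTo n (λ i → X i + Y i)                 ≈⟨ +-congˡ (sumTo-+ n X Y) ⟩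
    T 0 + (binomialSum r x n (h ∘ suc) + sumTo n Y)
      ≈⟨ solve 3 (λ a b c → a :+ (b :+ c) := (a :+ c) :+ b) refl _ _ _ ⟩
    (T 0 + sumTo n Y) + binomialSum r x n (h ∘ suc)
      ≈⟨ +-congʳ (sumTo-uncons n (λ i → t i (suc n ∸ i))) ⟨
    sumTo (suc n) (λ i → t i (suc n ∸ i)) + binomialSum r x n (h ∘ suc)
      ≈⟨ +-congʳ (sumTo-dropLast n _ (trans (*-congʳ (*-congʳ (*-congʳ
           (reflexive (≡.cong natF (k>n⇒nCk≡0 (ℕₚ.n<1+n n))))))) (trans (*-congʳ (0*x*y≈0 _ _)) (zeroˡ _)))) ⟩
    sumTo n (λ i → t i (suc n ∸ i)) + binomialSum r x n (h ∘ suc)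
      ≈⟨ +-congʳ (sumTo-factorExponent n (r * x) t (λ i e →
           solve 6 (λ c r w h x v → c :* (r :* w) :* h :* (x :* v) := r :* x :* (c :* w :* h :* v))
             refl _ r _ _ x _)) ⟩
    (r * x) * binomialSum r x n h + binomialSum r x n (h ∘ suc) ∎
    where
    T X Y : ℕ → Carrier
    T i = natF (suc n C i) * pow r (suc n ∸ i) * h i * pow x (suc n ∸ i)
    X i = natF (n C i) * pow r (n ∸ i) * h (suc i) * pow x (n ∸ i)
    Y i = natF (n C suc i) * pow r (n ∸ i) * h (suc i) * pow x (n ∸ i)
    t : ℕ → ℕ → Carrier
    t i e = natF (n C i) * pow r e * h i * pow x e
    pascal : ∀ i → T (suc i) ≈ X i + Y i
    pascal i = trans
      (*-congʳ (*-congʳ (*-congʳ (trans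
        (reflexive (≡.cong natF (≡.sym (nCk+nC[k+1]≡[n+1]C[k+1] n i)))) (natF-+ (n C i) _)))))
      (solve 5 (λ a b w g y → (a :+ b) :* w :* g :* y := a :* w :* g :* y :+ b :* w :* g :* y)
         refl _ _ _ _ _)

  module Recurrence (char0 : CharacteristicZero) (k : ℕ) (a q l la : Carrier)
                    (l≉0 : NonZero l) (a+j≉0 : ∀ j → NonZero (a + natF j)) (m : ℕ) where

    r A : Carrier
    r = - q
    A = a + natF m

    E : ℕ → Carrier
    E p = natF p + a + natF m

    weight weightRatio : ℕ → Carrier
    weight p = (natF (p !) ⁻¹ * (pow l p) ⁻¹) * pow (E p * A ⁻¹) k
    weightRatio p = l * natF (suc p) * pow (E p) k * (pow (E p + 1#) k) ⁻¹

    H : ℕ → ℕ → Carrier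
    H n p = Hc k a q l la n p m

    E-suc : ∀ p → E (suc p) ≈ E p + 1#
    E-suc p = solve 4 (λ n a m u → u :+ n :+ a :+ m := n :+ a :+ m :+ u) refl _ a _ 1#

    E-nonZero : ∀ p → NonZero (E p)
    E-nonZero p = NonZero-resp
      (trans (solve 3 (λ n a m → n :+ a :+ m := a :+ (n :+ m)) refl _ a _)
             (+-congˡ (sym (natF-+ p m))))
      (a+j≉0 (p ℕ.+ m))

    weightRatio-weight : ∀ p → weightRatio p * weight (suc p) ≈ weight p
    weightRatio-weight p = begin
      weightRatio p * weight (suc p)
        ≈⟨ *-congˡ (*-cong (*-cong fact-suc (⁻¹-distrib-* l≉0 (pow-nonZero p l≉0)))
             (trans (pow-distrib-* _ _ k) (*-congʳ (pow-cong k (E-suc p))))) ⟩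
      l * n1 * P * Q ⁻¹ * ((n1 ⁻¹ * fi) * (l ⁻¹ * li) * (Q * Ai))
        ≈⟨ solve 10 (λ l n1 P Qi n1i fi li′ li Q Ai →
             l :* n1 :* P :* Qi :* ((n1i :* fi) :* (li′ :* li) :* (Q :* Ai))
               := l :* li′ :* (n1 :* n1i :* (Q :* Qi :* (fi :* li :* (P :* Ai)))))
             refl l n1 P (Q ⁻¹) (n1 ⁻¹) fi (l ⁻¹) li Q Ai ⟩
      l * l ⁻¹ * (n1 * n1 ⁻¹ * (Q * Q ⁻¹ * (fi * li * (P * Ai))))
        ≈⟨ trans (unit-cancelˡ _ (inverse l l≉0)) (trans (unit-cancelˡ _ (inverse n1 (char0 p)))
             (unit-cancelˡ _ (inverse Q (NonZero-resp (sym (pow-cong k (E-suc p)))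
                                                      (pow-nonZero k (E-nonZero (suc p))))))) ⟩
      fi * li * (P * Ai)                 ≈⟨ *-congˡ (pow-distrib-* (E p) (A ⁻¹) k) ⟨
      weight p                           ∎
      where
      n1 = natF (suc p)
      fi = natF (p !) ⁻¹
      li = (pow l p) ⁻¹
      P = pow (E p) k
      Q = pow (E p + 1#) k
      Ai = pow (A ⁻¹) k
      fact-suc : natF (suc p !) ⁻¹ ≈ n1 ⁻¹ * fi
      fact-suc = trans (⁻¹-cong (*-nonZero (char0 p) (!-nonZero char0 p)) (natF-* (suc p) (p !)))
                       (⁻¹-distrib-* (char0 p) (!-nonZero char0 p))

    H-suc : ∀ n p → H (suc n) p ≈ weightRatio p * H n (suc p) + (natF p * r) * H n p
    H-suc n p = begin
      weight p * stirling1Sum r p (B ∘ (suc n ℕ.+_))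
        ≈⟨ *-congˡ (stirling1Sum-cong r p (λ i → reflexive (≡.cong B (≡.sym (ℕₚ.+-suc n i))))) ⟩
      weight p * stirling1Sum r p ((B ∘ (n ℕ.+_)) ∘ suc)
        ≈⟨ *-congˡ (stirling1Sum-suc r p _) ⟨
      weight p * (S₁ (suc p) + natF p * (r * S₁ p))
        ≈⟨ distribˡ _ _ _ ⟩
      weight p * S₁ (suc p) + weight p * (natF p * (r * S₁ p))
        ≈⟨ +-congʳ (*-congʳ (weightRatio-weight p)) ⟨
      weightRatio p * weight (suc p) * S₁ (suc p) + weight p * (natF p * (r * S₁ p))
        ≈⟨ solve 7 (λ c w′ u w n r z → c :* w′ :* u :+ w :* (n :* (r :* z))
                                        := c :* (w′ :* u) :+ n :* r :* (w :* z))
             refl _ _ _ _ _ r _ ⟩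
      weightRatio p * H n (suc p) + (natF p * r) * H n p ∎
      where
      B : ℕ → Carrier
      B i = calB k a q l la i m
      S₁ : ℕ → Carrier
      S₁ p = stirling1Sum r p (B ∘ (n ℕ.+_))

    Hpoly-suc : ∀ n p x → Hpoly k a q l la (suc n) p m x
      ≈ weightRatio p * Hpoly k a q l la n (suc p) m x - q * (x + natF p) * Hpoly k a q l la n p m x
    Hpoly-suc n p x = begin
      binomialSum r x (suc n) (λ i → H i p)
        ≈⟨ binomialSum-suc r x n _ ⟩
      (r * x) * Hp p + binomialSum r x n (λ i → H (suc i) p)
        ≈⟨ +-congˡ (binomialSum-cong r x n (λ i → H-suc i p)) ⟩
      (r * x) * Hp p + binomialSum r x n (λ i → weightRatio p * H i (suc p) + (natF p * r) * H i p)
        ≈⟨ +-congˡ (trans (binomialSum-+ r x n _ _)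
             (+-cong (binomialSum-*ˡ r x n _ _) (binomialSum-*ˡ r x n _ _))) ⟩
      (r * x) * Hp p + (weightRatio p * Hp (suc p) + (natF p * r) * Hp p)
        ≈⟨ solve 6 (λ q x h c h′ n → (:- q :* x) :* h :+ (c :* h′ :+ (n :* :- q) :* h)
                                        := c :* h′ :- q :* (x :+ n) :* h)
             refl q x _ _ _ _ ⟩
      weightRatio p * Hp (suc p) - q * (x + natF p) * Hp p ∎
      where
      Hp : ℕ → Carrier
      Hp p = binomialSum r x n (λ i → H i p)

    f : ℕ → Carrier
    f j = natF (j !) * (la * pow l j) * (pow (A + natF j) k) ⁻¹

    calB-stirling2Sum : ∀ i → calB k a q l la i m ≈ (pow A k * (pow a k) ⁻¹) * stirling2Sum r i f
    calB-stirling2Sum i = *-congˡ (sumTo-cong i (λ j →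
      solve 6 (λ j! w L D s la → j! :* w :* (la :* L) :* D :* s := w :* s :* (j! :* (la :* L) :* D))
        refl _ _ _ _ _ la))

    weight-f : ∀ p → weight p * (pow A k * (pow a k) ⁻¹ * f p) ≈ la * (pow a k) ⁻¹
    weight-f p = begin
      weight p * (PA * ai * (F! * (la * L) * (pow (A + natF p) k) ⁻¹))
        ≈⟨ *-cong (*-congˡ (pow-distrib-* (E p) (A ⁻¹) k))
                  (*-congˡ (*-congˡ (⁻¹-cong (pow-nonZero k (E-nonZero p))
                    (pow-cong k (solve 3 (λ a m n → a :+ m :+ n := n :+ a :+ m) refl a _ _))))) ⟩
      fi * li * (P * Ai) * (PA * ai * (F! * (la * L) * P ⁻¹))
        ≈⟨ solve 10 (λ fi li P Ai PA ai F! la L Pi →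
             fi :* li :* (P :* Ai) :* (PA :* ai :* (F! :* (la :* L) :* Pi))
               := F! :* fi :* (L :* li :* (P :* Pi :* (PA :* Ai :* (la :* ai)))))
             refl fi li P Ai PA ai F! la L (P ⁻¹) ⟩
      F! * fi * (L * li * (P * P ⁻¹ * (PA * Ai * (la * ai))))
        ≈⟨ trans (unit-cancelˡ _ (inverse F! (!-nonZero char0 p)))
            (trans (unit-cancelˡ _ (inverse L (pow-nonZero p l≉0)))
            (trans (unit-cancelˡ _ (inverse P (pow-nonZero k (E-nonZero p))))
                   (unit-cancelˡ _ (pow-inverse k (a+j≉0 m))))) ⟩
      la * ai ∎
      where
      F! = natF (p !)
      fi = F! ⁻¹
      L = pow l p
      li = L ⁻¹
      P = pow (E p) k
      Ai = pow (A ⁻¹) k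
      PA = pow A k
      ai = (pow a k) ⁻¹

    Hpoly-zero : ∀ p x → Hpoly k a q l la 0 p m x ≈ la * (pow a k) ⁻¹
    Hpoly-zero p x = begin
      binomialSum r x 0 (λ i → H i p)
        ≈⟨ binomialSum-zero r x (λ i → H i p) ⟩
      weight p * stirling1Sum r p (λ i → calB k a q l la i m)
        ≈⟨ *-congˡ (stirling1Sum-cong r p calB-stirling2Sum) ⟩
      weight p * stirling1Sum r p (λ i → pow A k * (pow a k) ⁻¹ * stirling2Sum r i f)
        ≈⟨ *-congˡ (trans (stirling1Sum-*ˡ r p _ _) (*-congˡ (stirling1Sum-stirling2Sum r p f))) ⟩
      weight p * (pow A k * (pow a k) ⁻¹ * f p)
        ≈⟨ weight-f p ⟩
      la * (pow a k) ⁻¹ ∎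

-- The hypotheses 1 ≤ k, a ≉ 0 and q ≉ 0 are not needed (a ≉ 0 is the case j = 0 of the last one).
theorem22 : ∀ {c ℓ : Level} (F : Field c ℓ) →
  let open Field F
      open FieldDefs F
  in CharacteristicZero →
     (k : ℕ) → 1 ≤ k →
     (a q : Carrier) (L : Vec Carrier k) (la : Carrier) →
     ¬ (a ≈ 0#) → ¬ (q ≈ 0#) → All (λ li → ¬ (li ≈ 0#)) L →
     (∀ (j : ℕ) → ¬ (a + natF j ≈ 0#)) →
     ∀ (n p m : ℕ) (x : Carrier) →
       (Hpoly k a q (prodV L) la (suc n) p m x
          ≈ (prodV L * natF (suc p) * pow (natF p + a + natF m) k
               * (pow (natF p + a + natF m + 1#) k) ⁻¹)
               * Hpoly k a q (prodV L) la n (suc p) m x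
            - q * (x + natF p) * Hpoly k a q (prodV L) la n p m x)
       × (Hpoly k a q (prodV L) la 0 p m x ≈ la * (pow a k) ⁻¹)
theorem22 F char0 k _ a q L la _ _ L≉0 a+j≉0 n p m x = Hpoly-suc n p x , Hpoly-zero p x
  where open Recurrence F char0 k a q (FieldDefs.prodV F L) la (prodV-nonZero F L L≉0) a+j≉0 m
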